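{- Let $H=(V,E)$ be a hypergraph with edge family $(e_i)_{i\in I}$ (all hyperedges nonempty), and let $p\le q$ be positive integers. The multivariate chromatic polynomial satisfies: (1) $P(E_0;p,q,\mathbf{t})=1$, where $E_0$ is the hypergraph with no vertices and no edges; (2) $P(E_1;p,q,\mathbf{t})=q$, where $E_1$ is the hypergraph with one vertex and no edges; (3) $P(H_1\sqcup H_2;p,q,\mathbf{t})=P(H_1;p,q,\mathbf{t})\cdot P(H_2;p,q,\mathbf{t})$ for a disjoint union of hypergraphs; (4) for every edge $e_i$ of $H$, $$P(H;p,q,\mathbf{t})=P(H-e_i;p,q,\mathbf{t}_{\neq e_i})+(t_i-1)P(H/e_i;p,q,\mathbf{t}_{\neq e_i})+(1-t_i)(q-p)P(H\dagger e_i;p,q,\mathbf{t}_{\perp e_i}),$$ where $\mathbf{t}_{\neq e_i}=(t_j)_{j\in I\setminus\{i\}}$ and $\mathbf{t}_{\perp e_i}=(t_j)_{j\neq i,\ e_j\cap e_i=\emptyset}$.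
   Context: A hypergraph $H=(V,E)$ consists of a finite vertex set $V$ and a finite indexed family $E=(e_i)_{i\in I}$ of subsets of $V$ (parallel edges allowed); here all hyperedges are nonempty. For positive integers $p\le q$, a $q$-coloring is a map $f:V\to\{1,\dots,q\}$; colors $1,\dots,p$ are primary. An edge $e_i$ is primary under $f$ if $f(u)=f(v)\le p$ for all $u,v\in e_i$; $P(f)$ is the set of indices of primary edges. With an indeterminate $t_i$ for each $i\in I$, $P(H;p,q,\mathbf{t})=\sum_{f:V\to[q]}\prod_{i\in P(f)}t_i$. For an edge $e_i$: deletion $H-e_i=(V,(e_j)_{j\neq i})$; extraction $H\dagger e_i=(V\setminus e_i,(e_j)_{j\neq i,\ e_j\cap e_i=\emptyset})$; contraction $H/e_i$ has vertex set $(V\setminus e_i)\cup\{v_i\}$ with $v_i$ new, and edges indexed by $j\neq i$, equal to $e_j$ if $e_j\cap e_i=\emptyset$ and to $(e_j\setminus e_i)\cup\{v_i\}$ otherwise. In these smaller hypergraphs the edge with index $j$ carries $t_j$. -}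

module Defs where

open import Level using (Level)
open import Data.Bool using (Bool; true; false; not; _∧_; if_then_else_)
open import Data.Nat using (ℕ; zero; suc; _<_; _+_; _<?_)
open import Data.Fin using (Fin; zero; suc; toℕ; splitAt; _≟_)
open import Data.Fin.Properties using (all?)
open import Data.Fin.Subset using (Subset; inside; outside; _∈_; _⊆_; _∩_; ∁; Nonempty; _-_; ⊥)
open import Data.Fin.Subset.Properties using (_∈?_; nonempty?)
open import Data.Maybe using (Maybe; just; nothing)
import Data.Maybe.Properties as MaybeP
open import Data.Vec using (Vec; []; _∷_; _++_; tabulate)
import Data.Vec.Functional as VF
open import Data.Sum using ([_,_]′; inj₁; inj₂)
open import Data.Product using (_×_)
import Data.Empty as E
open import Relation.Nullary using (Dec; yes; no; does)
open import Relation.Nullary.Decidable using (_×-dec_; _→-dec_)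
open import Relation.Binary.PropositionalEquality using (_≡_)
open import Algebra.Bundles using (CommutativeRing)

-- A hypergraph lives inside a vertex universe Fin n and an edge-index
-- universe Fin m: its vertex set is the subset V of Fin n, its index set
-- is the subset I of Fin m, and edge j (for j ∈ I) is the subset E j.
-- (Values of E outside I are irrelevant.)

record Hypergraph (n m : ℕ) : Set where
  constructor hg
  field
    V : Subset n
    I : Subset m
    E : Fin m → Subset n
open Hypergraph public

WellFormed : ∀ {n m} → Hypergraph n m → Set
WellFormed H = ∀ j → j ∈ I H → Nonempty (E H j) × (E H j ⊆ V H)

-- A q-colouring of V is represented as a function
-- f : Fin n → Maybe (Fin q) with f v ≡ just (colour) for v ∈ V and
-- f v ≡ nothing for v ∉ V (the sum below enumerates exactly these).
-- Colour c : Fin q stands for the colour toℕ c + 1 ∈ {1..q}; it is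
-- primary iff toℕ c < p.

IsPrimaryColour : ∀ {q} (p : ℕ) → Maybe (Fin q) → Set
IsPrimaryColour p (just c) = toℕ c < p
IsPrimaryColour p nothing  = E.⊥

isPrimaryColour? : ∀ {q} (p : ℕ) (x : Maybe (Fin q)) → Dec (IsPrimaryColour p x)
isPrimaryColour? p (just c) = toℕ c <? p
isPrimaryColour? p nothing  = no (λ ())

PrimaryEdge : ∀ {n q} (p : ℕ) → (Fin n → Maybe (Fin q)) → Subset n → Set
PrimaryEdge p f e = ∀ u v → u ∈ e → v ∈ e → (f u ≡ f v) × IsPrimaryColour p (f u)

primaryEdge? : ∀ {n q} (p : ℕ) (f : Fin n → Maybe (Fin q)) (e : Subset n) →
               Dec (PrimaryEdge p f e)
primaryEdge? p f e =
  all? (λ u → all? (λ v → (u ∈? e) →-dec ((v ∈? e) →-dec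
    (MaybeP.≡-dec _≟_ (f u) (f v) ×-dec isPrimaryColour? p (f u)))))

deleteEdge : ∀ {n m} → Hypergraph n m → Fin m → Hypergraph n m
deleteEdge H i = hg (V H) (I H - i) (E H)

extractEdge : ∀ {n m} → Hypergraph n m → Fin m → Hypergraph n m
extractEdge H i =
  hg (V H ∩ ∁ (E H i))
     (tabulate λ j → does (j ∈? I H) ∧ not (does (j ≟ i))
                       ∧ not (does (nonempty? (E H j ∩ E H i))))
     (E H)

-- contraction H / e_i: the new vertex v_i is vertex zero of Fin (suc n),
-- old vertex v becomes suc v.
contractEdge : ∀ {n m} → Hypergraph n m → Fin m → Hypergraph (suc n) m
contractEdge H i =
  hg (inside ∷ (V H ∩ ∁ (E H i)))
     (I H - i)
     (λ j → (if does (nonempty? (E H j ∩ E H i)) then inside else outside)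
              ∷ (E H j ∩ ∁ (E H i)))

disjointUnion : ∀ {n₁ m₁ n₂ m₂} → Hypergraph n₁ m₁ → Hypergraph n₂ m₂ →
                Hypergraph (n₁ + n₂) (m₁ + m₂)
disjointUnion {n₁} {m₁} {n₂} {m₂} H₁ H₂ =
  hg (V H₁ ++ V H₂) (I H₁ ++ I H₂)
     (λ j → [ (λ j₁ → E H₁ j₁ ++ ⊥) , (λ j₂ → ⊥ ++ E H₂ j₂) ]′ (splitAt m₁ j))

joinWeights : ∀ {a} {A : Set a} {m₁ m₂} → (Fin m₁ → A) → (Fin m₂ → A) → Fin (m₁ + m₂) → A
joinWeights {m₁ = m₁} t₁ t₂ j = [ t₁ , t₂ ]′ (splitAt m₁ j)

-- The multivariate chromatic polynomial, evaluated in an arbitrary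
-- commutative ring R (an identity holding for all R and all t is the
-- same as an identity of polynomials in the indeterminates t_i).

module _ {c ℓ : Level} (R : CommutativeRing c ℓ) where
  open CommutativeRing R using (Carrier; 0#; 1#) renaming (_+_ to _+R_; _*_ to _*R_)

  natR : ℕ → Carrier
  natR zero    = 0#
  natR (suc k) = 1# +R natR k

  sumFin : ∀ k → (Fin k → Carrier) → Carrier
  sumFin zero    g = 0#
  sumFin (suc k) g = g zero +R sumFin k (λ x → g (suc x))

  prodFin : ∀ k → (Fin k → Carrier) → Carrier
  prodFin zero    g = 1#
  prodFin (suc k) g = g zero *R prodFin k (λ x → g (suc x))

  sumColourings : ∀ {n} (q : ℕ) → Subset n → ((Fin n → Maybe (Fin q)) → Carrier) → Carrier
  sumColourings q []            F = F (λ ())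
  sumColourings q (inside ∷ V)  F = sumFin q (λ c → sumColourings q V (λ g → F (just c VF.∷ g)))
  sumColourings q (outside ∷ V) F = sumColourings q V (λ g → F (nothing VF.∷ g))

  primaryWeight : ∀ {n m q} (p : ℕ) → Hypergraph n m → (Fin m → Carrier) →
                  (Fin n → Maybe (Fin q)) → Carrier
  primaryWeight {m = m} p H t f =
    prodFin m (λ j → if does (j ∈? I H) ∧ does (primaryEdge? p f (E H j)) then t j else 1#)

  chromPoly : ∀ {n m} (p q : ℕ) → Hypergraph n m → (Fin m → Carrier) → Carrier
  chromPoly p q H t = sumColourings q (V H) (primaryWeight p H t)

-- Splitting off the factor of e_i from the weight of a colouring f (it is t_i if e_i
-- is primary under f and 1 otherwise) gives P(H) = P(H - e_i) + (t_i - 1) A, where A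
-- sums the weights of H - e_i over the colourings under which e_i is primary.
-- A colouring of H / e_i is a colouring of V \ e_i together with a colour c of the new
-- vertex, that is, a colouring of V painting all of e_i with c.  Since a nonempty edge
-- is primary exactly when it is monochromatic in a (necessarily unique) primary colour,
-- the primary colours c contribute A; for each of the q - p other colours no edge
-- meeting e_i is primary, so the weight is that of H † e_i.  Thus
-- P(H / e_i) = A + (q - p) P(H † e_i), and eliminating A gives (4).  Properties
-- (1)-(3) come from factoring the sum over colourings.

module Submission where

open import Defs
open import Data.Bool using (Bool; true; false; _∧_; if_then_else_)
open import Data.Bool.Properties using (T-≡)
open import Data.Empty using (⊥-elim)
open import Data.Fin using (Fin; zero; suc; toℕ; splitAt; _↑ˡ_; _↑ʳ_) renaming (_≟_ to _≟ᶠ_)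
import Data.Fin.Properties as Finₚ
open import Data.Fin.Subset
  using (Subset; inside; outside; _∈_; _∉_; _⊆_; _∩_; ∁; Nonempty; _─_; ⁅_⁆; ⊥; ∣_∣)
open import Data.Fin.Subset.Properties
  using ( _∈?_; nonempty?; ∉⊥; ∣⊥∣≡0; drop-∷-⊆; x∈p∩q⁺; x∈p∩q⁻; x∉p⇒x∈∁p; x∈∁p⇒x∉p
        ; p─q⊆p; x∈p∧x≢y⇒x∈p-y)
open import Data.Maybe using (Maybe; just; nothing)
import Data.Maybe.Properties as Maybeₚ
open import Data.Nat as ℕ using (ℕ; zero; suc; _≤_; _<_; _<?_; _∸_)
import Data.Nat.Properties as ℕₚ
open import Data.Product using (∃-syntax; _×_; _,_; proj₁; proj₂)
open import Data.Sum using (inj₁; inj₂; [_,_]′)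
open import Data.Vec using (_∷_; []; _++_; tabulate; lookup; here; there)
import Data.Vec.Properties as Vecₚ
import Data.Vec.Functional as VF
open import Function using (_∘_; _⇔_; mk⇔; Equivalence)
open import Relation.Nullary using (Dec; yes; no; does; ¬_; ¬?)
open import Relation.Nullary.Decidable
  using (dec-true; dec-false; does-⇔; _×-dec_; _→-dec_; toWitness; isYes≗does)
open import Relation.Binary.PropositionalEquality using (_≡_; _≢_; refl; sym; trans; cong; subst)
open import Algebra.Bundles using (CommutativeRing)
open import Data.Product.Function.NonDependent.Propositional using (_×-⇔_)
import Function.Properties.Equivalence as ⇔
import Algebra.Properties.CommutativeSemigroup as CommutativeSemigroupProperties

x∉p─⁅x⁆ : ∀ {n} (p : Subset n) x → x ∉ p ─ ⁅ x ⁆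
x∉p─⁅x⁆ (_ ∷ p) zero    ()
x∉p─⁅x⁆ (_ ∷ p) (suc x) (there x∈p─⁅x⁆) = x∉p─⁅x⁆ p x x∈p─⁅x⁆

x∈p─⁅y⁆⇔ : ∀ {n} {p : Subset n} {x y} → x ∈ p ─ ⁅ y ⁆ ⇔ (x ∈ p × x ≢ y)
x∈p─⁅y⁆⇔ {p = p} {x} = mk⇔
  (λ x∈ → p─q⊆p p _ x∈ , λ { refl → x∉p─⁅x⁆ p x x∈ })
  (λ (x∈p , x≢y) → x∈p∧x≢y⇒x∈p-y x∈p x≢y)

∈-tabulate-does : ∀ {n ℓ} {P : Fin n → Set ℓ} (P? : ∀ x → Dec (P x)) x →
                  x ∈ tabulate (does ∘ P?) ⇔ P x
∈-tabulate-does P? x = mk⇔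
  (λ x∈ → toWitness {a? = P? x} (Equivalence.from T-≡
             (trans (isYes≗does (P? x)) (trans (sym lookup≡) (Vecₚ.[]=⇒lookup x∈)))))
  (λ px → Vecₚ.lookup⇒[]= x _ (trans lookup≡ (dec-true (P? x) px)))
  where
  lookup≡ : lookup (tabulate (does ∘ P?)) x ≡ does (P? x)
  lookup≡ = Vecₚ.lookup∘tabulate (does ∘ P?) x

∈-++⁻ : ∀ {n₁ n₂} (p : Subset n₁) (q : Subset n₂) {x} →
        x ∈ p ++ q → [ _∈ p , _∈ q ]′ (splitAt n₁ x)
∈-++⁻ {n₁} p q {x} x∈ =
  split (splitAt n₁ x) (trans (sym (Vecₚ.lookup-splitAt n₁ p q x)) (Vecₚ.[]=⇒lookup x∈))
  where
  split : ∀ s → [ lookup p , lookup q ]′ s ≡ inside → [ _∈ p , _∈ q ]′ s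
  split (inj₁ y) eq = Vecₚ.lookup⇒[]= y p eq
  split (inj₂ y) eq = Vecₚ.lookup⇒[]= y q eq

∈-++ˡ⇔ : ∀ {n₁ n₂} (p : Subset n₁) (q : Subset n₂) {x} → x ↑ˡ n₂ ∈ p ++ q ⇔ x ∈ p
∈-++ˡ⇔ p q {x} = mk⇔
  (λ x∈ → Vecₚ.lookup⇒[]= x p (trans (sym (Vecₚ.lookup-++ˡ p q x)) (Vecₚ.[]=⇒lookup x∈)))
  (λ x∈ → Vecₚ.lookup⇒[]= _ (p ++ q) (trans (Vecₚ.lookup-++ˡ p q x) (Vecₚ.[]=⇒lookup x∈)))

∈-++ʳ⇔ : ∀ {n₁ n₂} (p : Subset n₁) (q : Subset n₂) {x} → n₁ ↑ʳ x ∈ p ++ q ⇔ x ∈ q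
∈-++ʳ⇔ p q {x} = mk⇔
  (λ x∈ → Vecₚ.lookup⇒[]= x q (trans (sym (Vecₚ.lookup-++ʳ p q x)) (Vecₚ.[]=⇒lookup x∈)))
  (λ x∈ → Vecₚ.lookup⇒[]= _ (p ++ q) (trans (Vecₚ.lookup-++ʳ p q x) (Vecₚ.[]=⇒lookup x∈)))

Colouring : ℕ → ℕ → Set
Colouring q n = Fin n → Maybe (Fin q)

ColourOn : ∀ {q n} → Colouring q n → Subset n → Maybe (Fin q) → Set
ColourOn f e x = ∃[ v ] v ∈ e × f v ≡ x

SameColours : ∀ {q n n′} → Colouring q n → Subset n → Colouring q n′ → Subset n′ → Set
SameColours f e g e′ = ∀ {x} → ColourOn f e x ⇔ ColourOn g e′ x

module _ {q : ℕ} where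

  sameColours-agree : ∀ {n} {f g : Colouring q n} {e} → (∀ {v} → v ∈ e → f v ≡ g v) → SameColours f e g e
  sameColours-agree f≡g = mk⇔ (λ (v , v∈ , fv≡x) → v , v∈ , trans (sym (f≡g v∈)) fv≡x)
                              (λ (v , v∈ , gv≡x) → v , v∈ , trans (f≡g v∈) gv≡x)

  primaryEdge-⊇ : ∀ {p n n′} {f : Colouring q n} {e} {g : Colouring q n′} {e′} →
                  (∀ {x} → ColourOn g e′ x → ColourOn f e x) → PrimaryEdge p f e → PrimaryEdge p g e′
  primaryEdge-⊇ {p} g⊆f pe u v u∈ v∈
    with (u′ , u′∈ , fu′≡gu) ← g⊆f (u , u∈ , refl)
       | (v′ , v′∈ , fv′≡gv) ← g⊆f (v , v∈ , refl)
    = let (fu′≡fv′ , primary) = pe u′ v′ u′∈ v′∈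
      in trans (sym fu′≡gu) (trans fu′≡fv′ fv′≡gv) , subst (IsPrimaryColour p) fu′≡gu primary

  primaryEdge-⇔ : ∀ {p n n′} {f : Colouring q n} {e} {g : Colouring q n′} {e′} →
                  SameColours f e g e′ → PrimaryEdge p f e ⇔ PrimaryEdge p g e′
  primaryEdge-⇔ same = mk⇔ (primaryEdge-⊇ (Equivalence.from same)) (primaryEdge-⊇ (Equivalence.to same))

  paint : ∀ {n} → Subset n → Fin q → Colouring q n → Colouring q n
  paint (_       ∷ e) c g (suc v) = paint e c (g ∘ suc) v
  paint (inside  ∷ e) c g zero    = just c
  paint (outside ∷ e) c g zero    = g zero

  paint-∈ : ∀ {n} (e : Subset n) c g {v} → v ∈ e → paint e c g v ≡ just c
  paint-∈ (inside ∷ e) c g here        = refl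
  paint-∈ (_      ∷ e) c g (there v∈e) = paint-∈ e c (g ∘ suc) v∈e

  paint-∉ : ∀ {n} (e : Subset n) c g {v} → v ∉ e → paint e c g v ≡ g v
  paint-∉ (inside  ∷ e) c g {zero}  v∉e = ⊥-elim (v∉e here)
  paint-∉ (outside ∷ e) c g {zero}  v∉e = refl
  paint-∉ (_       ∷ e) c g {suc v} v∉e = paint-∉ e c (g ∘ suc) (v∉e ∘ there)

  paint-∷ : ∀ {n} s (e : Subset n) c a g v →
            paint (s ∷ e) c (a VF.∷ g) v ≡ (paint (s ∷ e) c (a VF.∷ g) zero VF.∷ paint e c g) v
  paint-∷ s e c a g zero    = refl
  paint-∷ s e c a g (suc v) = refl

  Monochrome : ∀ {n} → Subset n → Fin q → Colouring q n → Set
  Monochrome e c f = ∀ v → v ∈ e → f v ≡ just c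

  monochrome? : ∀ {n} (e : Subset n) c f → Dec (Monochrome e c f)
  monochrome? e c f = Finₚ.all? λ v → (v ∈? e) →-dec Maybeₚ.≡-dec _≟ᶠ_ (f v) (just c)

  monochrome-outside : ∀ {n} {e : Subset n} {c a f} → Monochrome (outside ∷ e) c (a VF.∷ f) ⇔ Monochrome e c f
  monochrome-outside = mk⇔ (λ mono v v∈ → mono (suc v) (there v∈))
                           (λ { mono (suc v) (there v∈) → mono v v∈ })

  monochrome-inside : ∀ {n} {e : Subset n} {c a f} →
                      Monochrome (inside ∷ e) c (a VF.∷ f) ⇔ (a ≡ just c × Monochrome e c f)
  monochrome-inside = mk⇔ (λ mono → mono zero here , λ v v∈ → mono (suc v) (there v∈))
                          (λ { (a≡c , mono) zero here → a≡c
                             ; (a≡c , mono) (suc v) (there v∈) → mono v v∈ })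

  monochrome-unique : ∀ {n} {e : Subset n} {c d f} → Nonempty e →
                      Monochrome e c f → Monochrome e d f → c ≡ d
  monochrome-unique (w , w∈) mono-c mono-d =
    Maybeₚ.just-injective (trans (sym (mono-c w w∈)) (mono-d w w∈))

  monochrome⇒primaryEdge : ∀ {p n} {e : Subset n} {c f} → toℕ c < p → Monochrome e c f → PrimaryEdge p f e
  monochrome⇒primaryEdge {p} c<p mono u v u∈ v∈ =
    trans (mono u u∈) (sym (mono v v∈)) , subst (IsPrimaryColour p) (sym (mono u u∈)) c<p

  primaryEdge⇒monochrome : ∀ {p n} {e : Subset n} {f} → Nonempty e → PrimaryEdge p f e →
                           ∃[ c ] toℕ c < p × Monochrome e c f
  primaryEdge⇒monochrome {p} {e = e} {f} (w , w∈) pe = colourOf (f w) refl (proj₂ (pe w w w∈ w∈))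
    where
    colourOf : ∀ x → f w ≡ x → IsPrimaryColour p x → ∃[ c ] toℕ c < p × Monochrome e c f
    colourOf (just c) fw≡c c<p = c , c<p , λ v v∈ → trans (sym (proj₁ (pe w v w∈ v∈))) fw≡c

  sameColours-contract : ∀ {n} (e′ e : Subset n) c g (meets? : Dec (Nonempty (e′ ∩ e))) →
    SameColours (just c VF.∷ g) ((if does meets? then inside else outside) ∷ (e′ ∩ ∁ e)) (paint e c g) e′
  sameColours-contract e′ e c g meets? = mk⇔ (from meets?) (to meets?)
    where
    from : ∀ meets? {x} →
           ColourOn (just c VF.∷ g) ((if does meets? then inside else outside) ∷ (e′ ∩ ∁ e)) x →
           ColourOn (paint e c g) e′ x
    from (yes (w , w∈)) (zero , here , c≡x) =
      w , proj₁ (x∈p∩q⁻ e′ e w∈) , trans (paint-∈ e c g (proj₂ (x∈p∩q⁻ e′ e w∈))) c≡x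
    from _ (suc v , there v∈ , gv≡x) =
      let (v∈e′ , v∈∁e) = x∈p∩q⁻ e′ (∁ e) v∈
      in v , v∈e′ , trans (paint-∉ e c g (x∈∁p⇒x∉p v∈∁e)) gv≡x
    to : ∀ meets? {x} → ColourOn (paint e c g) e′ x →
         ColourOn (just c VF.∷ g) ((if does meets? then inside else outside) ∷ (e′ ∩ ∁ e)) x
    to meets? (v , v∈e′ , eq) with v ∈? e | meets?
    ... | yes v∈e | yes _  = zero , here , trans (sym (paint-∈ e c g v∈e)) eq
    ... | yes v∈e | no ¬meets = ⊥-elim (¬meets (v , x∈p∩q⁺ (v∈e′ , v∈e)))
    ... | no v∉e  | _      =
      suc v , there (x∈p∩q⁺ (v∈e′ , x∉p⇒x∈∁p v∉e)) , trans (sym (paint-∉ e c g v∉e)) eq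

  sameColours-joinˡ : ∀ {n₁ n₂} (f₁ : Colouring q n₁) (f₂ : Colouring q n₂) e →
                      SameColours (joinWeights f₁ f₂) (e ++ ⊥) f₁ e
  sameColours-joinˡ {n₁} {n₂} f₁ f₂ e = mk⇔
    (λ (v , v∈ , eq) → from (splitAt n₁ v) (∈-++⁻ e ⊥ v∈) eq)
    (λ (u , u∈ , eq) → u ↑ˡ n₂ , Equivalence.from (∈-++ˡ⇔ e ⊥) u∈ ,
                       trans (cong [ f₁ , f₂ ]′ (Finₚ.splitAt-↑ˡ n₁ u n₂)) eq)
    where
    from : ∀ {x} s → [ _∈ e , _∈ ⊥ ]′ s → [ f₁ , f₂ ]′ s ≡ x → ColourOn f₁ e x
    from (inj₁ u) u∈  eq = u , u∈ , eq
    from (inj₂ u) u∈⊥ _  = ⊥-elim (∉⊥ u∈⊥)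

  sameColours-joinʳ : ∀ {n₁ n₂} (f₁ : Colouring q n₁) (f₂ : Colouring q n₂) e →
                      SameColours (joinWeights f₁ f₂) (⊥ ++ e) f₂ e
  sameColours-joinʳ {n₁} {n₂} f₁ f₂ e = mk⇔
    (λ (v , v∈ , eq) → from (splitAt n₁ v) (∈-++⁻ ⊥ e v∈) eq)
    (λ (u , u∈ , eq) → n₁ ↑ʳ u , Equivalence.from (∈-++ʳ⇔ ⊥ e) u∈ ,
                       trans (cong [ f₁ , f₂ ]′ (Finₚ.splitAt-↑ʳ n₁ n₂ u)) eq)
    where
    from : ∀ {x} s → [ _∈ ⊥ , _∈ e ]′ s → [ f₁ , f₂ ]′ s ≡ x → ColourOn f₂ e x
    from (inj₁ u) u∈⊥ _  = ⊥-elim (∉⊥ u∈⊥)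
    from (inj₂ u) u∈  eq = u , u∈ , eq

∈-extractEdge : ∀ {n m} (H : Hypergraph n m) i j →
                j ∈ I (extractEdge H i) ⇔ (j ∈ I H × j ≢ i × ¬ Nonempty (E H j ∩ E H i))
∈-extractEdge H i =
  ∈-tabulate-does λ j → (j ∈? I H) ×-dec ¬? (j ≟ᶠ i) ×-dec ¬? (nonempty? (E H j ∩ E H i))

module FiniteSums {c ℓ} (R : CommutativeRing c ℓ) where
  open CommutativeRing R hiding (zero) renaming (refl to ≈-refl; sym to ≈-sym; trans to ≈-trans)
  open import Relation.Binary.Reasoning.Setoid setoid
  open CommutativeSemigroupProperties +-commutativeSemigroup using () renaming (interchange to +-interchange)
  open CommutativeSemigroupProperties *-commutativeSemigroup using () renaming (x∙yz≈y∙xz to x*[y*z]≈y*[x*z])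

  ∑ ∏ : ∀ k → (Fin k → Carrier) → Carrier
  ∑ = sumFin R
  ∏ = prodFin R

  infixl 10 ∑ ∏
  syntax ∑ k (λ x → g) = ∑[ x < k ] g
  syntax ∏ k (λ x → g) = ∏[ x < k ] g

  if-cong : ∀ b {x y z w} → x ≈ y → z ≈ w → (if b then x else z) ≈ (if b then y else w)
  if-cong true  x≈y _   = x≈y
  if-cong false _   z≈w = z≈w

  if-does-congʳ : ∀ {a} {P : Set a} (P? : Dec P) {x y z} → (¬ P → y ≈ z) →
                  (if does P? then x else y) ≈ (if does P? then x else z)
  if-does-congʳ (yes _) _   = ≈-refl
  if-does-congʳ (no ¬P) y≈z = y≈z ¬P

  if-congᵇ : ∀ {b b′ x y} → b ≡ b′ → (if b then x else y) ≈ (if b′ then x else y)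
  if-congᵇ refl = ≈-refl

  if-partition : ∀ b x → x ≈ (if b then x else 0#) + (if b then 0# else x)
  if-partition true  x = ≈-sym (+-identityʳ x)
  if-partition false x = ≈-sym (+-identityˡ x)

  sumFin-cong : ∀ k {g h : Fin k → Carrier} → (∀ x → g x ≈ h x) → ∑[ x < k ] g x ≈ ∑[ x < k ] h x
  sumFin-cong zero    g≈h = ≈-refl
  sumFin-cong (suc k) g≈h = +-cong (g≈h zero) (sumFin-cong k (g≈h ∘ suc))

  sumFin-zero : ∀ k → ∑[ _ < k ] 0# ≈ 0#
  sumFin-zero zero    = ≈-refl
  sumFin-zero (suc k) = ≈-trans (+-congˡ (sumFin-zero k)) (+-identityʳ 0#)

  sumFin-+ : ∀ k (g h : Fin k → Carrier) →
             ∑[ x < k ] (g x + h x) ≈ ∑[ x < k ] g x + ∑[ x < k ] h x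
  sumFin-+ zero    g h = ≈-sym (+-identityʳ 0#)
  sumFin-+ (suc k) g h = ≈-trans (+-congˡ (sumFin-+ k (g ∘ suc) (h ∘ suc))) (+-interchange _ _ _ _)

  sumFin-*ˡ : ∀ k a (g : Fin k → Carrier) → ∑[ x < k ] (a * g x) ≈ a * ∑[ x < k ] g x
  sumFin-*ˡ zero    a g = ≈-sym (zeroʳ a)
  sumFin-*ˡ (suc k) a g =
    ≈-trans (+-congˡ (sumFin-*ˡ k a (g ∘ suc))) (≈-sym (distribˡ a _ _))

  sumFin-const : ∀ k a → ∑[ _ < k ] a ≈ natR R k * a
  sumFin-const zero    a = ≈-sym (zeroˡ a)
  sumFin-const (suc k) a = begin
    a + ∑[ _ < k ] a ≈⟨ +-cong (≈-sym (*-identityˡ a)) (sumFin-const k a) ⟩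
    1# * a + natR R k * a    ≈⟨ distribʳ a 1# (natR R k) ⟨
    (1# + natR R k) * a      ∎

  sumFin-δ : ∀ k (c : Fin k) (g : Fin k → Carrier) →
             ∑[ d < k ] (if does (d ≟ᶠ c) then g d else 0#) ≈ g c
  sumFin-δ (suc k) zero    g = ≈-trans (+-congˡ (sumFin-zero k)) (+-identityʳ (g zero))
  sumFin-δ (suc k) (suc c) g = ≈-trans (+-identityˡ _) (sumFin-δ k c (g ∘ suc))

  sumFin-swap : ∀ k l (g : Fin k → Fin l → Carrier) →
                ∑[ x < k ] ∑[ y < l ] g x y ≈ ∑[ y < l ] ∑[ x < k ] g x y
  sumFin-swap zero    l g = ≈-sym (sumFin-zero l)
  sumFin-swap (suc k) l g = begin
    ∑[ y < l ] g zero y + ∑[ x < k ] ∑[ y < l ] g (suc x) y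
      ≈⟨ +-congˡ (sumFin-swap k l (g ∘ suc)) ⟩
    ∑[ y < l ] g zero y + ∑[ y < l ] ∑[ x < k ] g (suc x) y
      ≈⟨ sumFin-+ l _ _ ⟨
    ∑[ y < l ] (g zero y + ∑[ x < k ] g (suc x) y) ∎

  sumFin-partition : ∀ k (b : Fin k → Bool) (g : Fin k → Carrier) →
    ∑[ x < k ] g x ≈ ∑[ x < k ] (if b x then g x else 0#) + ∑[ x < k ] (if b x then 0# else g x)
  sumFin-partition k b g =
    ≈-trans (sumFin-cong k (λ x → if-partition (b x) (g x))) (sumFin-+ k _ _)

  sumFin-const-≥ : ∀ k p a → ∑[ x < k ] (if does (toℕ x <? p) then 0# else a) ≈ natR R (k ∸ p) * a
  sumFin-const-≥ zero    zero    a = ≈-sym (zeroˡ a)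
  sumFin-const-≥ zero    (suc p) a = ≈-sym (zeroˡ a)
  sumFin-const-≥ (suc k) zero    a = sumFin-const (suc k) a
  sumFin-const-≥ (suc k) (suc p) a = ≈-trans (+-identityˡ _) (sumFin-const-≥ k p a)

  prodFin-cong : ∀ k {g h : Fin k → Carrier} → (∀ x → g x ≈ h x) → ∏[ x < k ] g x ≈ ∏[ x < k ] h x
  prodFin-cong zero    g≈h = ≈-refl
  prodFin-cong (suc k) g≈h = *-cong (g≈h zero) (prodFin-cong k (g≈h ∘ suc))

  prodFin-one : ∀ k {g : Fin k → Carrier} → (∀ x → g x ≈ 1#) → ∏[ x < k ] g x ≈ 1#
  prodFin-one zero    g≈1 = ≈-refl
  prodFin-one (suc k) g≈1 = ≈-trans (*-cong (g≈1 zero) (prodFin-one k (g≈1 ∘ suc))) (*-identityˡ 1#)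

  prodFin-extract : ∀ k (i : Fin k) (g h : Fin k → Carrier) →
                    (∀ x → x ≢ i → g x ≈ h x) → h i ≈ 1# → ∏[ x < k ] g x ≈ g i * ∏[ x < k ] h x
  prodFin-extract (suc k) zero    g h g≈h hi≈1 = *-congˡ (begin
    ∏[ x < k ] g (suc x)            ≈⟨ prodFin-cong k (λ x → g≈h (suc x) λ ()) ⟩
    ∏[ x < k ] h (suc x)            ≈⟨ *-identityˡ _ ⟨
    1# * ∏[ x < k ] h (suc x)       ≈⟨ *-congʳ hi≈1 ⟨
    h zero * ∏[ x < k ] h (suc x)   ∎)
  prodFin-extract (suc k) (suc i) g h g≈h hi≈1 = begin
    g zero * ∏[ x < k ] g (suc x)
      ≈⟨ *-cong (g≈h zero λ ())
                (prodFin-extract k i (g ∘ suc) (h ∘ suc) (λ x x≢i → g≈h (suc x) (x≢i ∘ Finₚ.suc-injective)) hi≈1) ⟩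
    h zero * (g (suc i) * ∏[ x < k ] h (suc x))
      ≈⟨ x*[y*z]≈y*[x*z] _ _ _ ⟩
    g (suc i) * (h zero * ∏[ x < k ] h (suc x)) ∎

  prodFin-++ : ∀ k l (g : Fin (k ℕ.+ l) → Carrier) →
               ∏[ x < k ℕ.+ l ] g x ≈ ∏[ x < k ] g (x ↑ˡ l) * ∏[ y < l ] g (k ↑ʳ y)
  prodFin-++ zero    l g = ≈-sym (*-identityˡ _)
  prodFin-++ (suc k) l g = ≈-trans (*-congˡ (prodFin-++ k l (g ∘ suc))) (≈-sym (*-assoc _ _ _))

module ColouringSums {c ℓ} (R : CommutativeRing c ℓ) (q : ℕ) where
  open CommutativeRing R hiding (zero) renaming (refl to ≈-refl; sym to ≈-sym; trans to ≈-trans)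
  open FiniteSums R
  open import Relation.Binary.Reasoning.Setoid setoid

  ∑ᶜ : ∀ {n} → Subset n → (Colouring q n → Carrier) → Carrier
  ∑ᶜ = sumColourings R q

  infixl 10 ∑ᶜ
  syntax ∑ᶜ V (λ f → F) = ∑[ f ∈ V ] F

  Extensional : ∀ {n} → (Colouring q n → Carrier) → Set ℓ
  Extensional F = ∀ {f g} → (∀ v → f v ≡ g v) → F f ≈ F g

  extensional-∷ : ∀ {n} {F : Colouring q (suc n) → Carrier} → Extensional F →
                  ∀ a → Extensional (λ f → F (a VF.∷ f))
  extensional-∷ ext a f≗g = ext λ { zero → refl ; (suc v) → f≗g v }

  sumColourings-cong : ∀ {n} (V : Subset n) {F G : Colouring q n → Carrier} → (∀ f → F f ≈ G f) →
                       ∑[ f ∈ V ] F f ≈ ∑[ f ∈ V ] G f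
  sumColourings-cong []            F≈G = F≈G _
  sumColourings-cong (inside ∷ V)  F≈G = sumFin-cong q λ _ → sumColourings-cong V (F≈G ∘ _)
  sumColourings-cong (outside ∷ V) F≈G = sumColourings-cong V (F≈G ∘ _)

  sumColourings-zero : ∀ {n} (V : Subset n) → ∑[ _ ∈ V ] 0# ≈ 0#
  sumColourings-zero []            = ≈-refl
  sumColourings-zero (inside ∷ V)  = ≈-trans (sumFin-cong q λ _ → sumColourings-zero V) (sumFin-zero q)
  sumColourings-zero (outside ∷ V) = sumColourings-zero V

  sumColourings-+ : ∀ {n} (V : Subset n) (F G : Colouring q n → Carrier) →
    ∑[ f ∈ V ] (F f + G f) ≈ ∑[ f ∈ V ] F f + ∑[ f ∈ V ] G f
  sumColourings-+ []            F G = ≈-refl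
  sumColourings-+ (inside ∷ V)  F G = ≈-trans (sumFin-cong q λ _ → sumColourings-+ V _ _) (sumFin-+ q _ _)
  sumColourings-+ (outside ∷ V) F G = sumColourings-+ V _ _

  sumColourings-*ˡ : ∀ {n} (V : Subset n) a (F : Colouring q n → Carrier) →
                     ∑[ f ∈ V ] (a * F f) ≈ a * ∑[ f ∈ V ] F f
  sumColourings-*ˡ []            a F = ≈-refl
  sumColourings-*ˡ (inside ∷ V)  a F = ≈-trans (sumFin-cong q λ _ → sumColourings-*ˡ V a _) (sumFin-*ˡ q a _)
  sumColourings-*ˡ (outside ∷ V) a F = sumColourings-*ˡ V a _

  sumColourings-if-∧ : ∀ {n} (V : Subset n) b (B : Colouring q n → Bool) (F : Colouring q n → Carrier) →
    ∑[ f ∈ V ] (if b ∧ B f then F f else 0#)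
      ≈ (if b then ∑[ f ∈ V ] (if B f then F f else 0#) else 0#)
  sumColourings-if-∧ V true  B F = ≈-refl
  sumColourings-if-∧ V false B F = sumColourings-zero V

  sumColourings-sumFin : ∀ {n} (V : Subset n) k (G : Fin k → Colouring q n → Carrier) →
    ∑[ f ∈ V ] ∑[ x < k ] G x f ≈ ∑[ x < k ] ∑[ f ∈ V ] G x f
  sumColourings-sumFin []            k G = ≈-refl
  sumColourings-sumFin (inside ∷ V)  k G =
    ≈-trans (sumFin-cong q λ d → sumColourings-sumFin V k _) (sumFin-swap q k _)
  sumColourings-sumFin (outside ∷ V) k G = sumColourings-sumFin V k _

  sumColourings-const-∣∣≡0 : ∀ {n} (V : Subset n) a → ∣ V ∣ ≡ 0 → ∑[ _ ∈ V ] a ≈ a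
  sumColourings-const-∣∣≡0 []            a _    = ≈-refl
  sumColourings-const-∣∣≡0 (outside ∷ V) a ∣V∣≡0 = sumColourings-const-∣∣≡0 V a ∣V∣≡0

  sumColourings-const-∣∣≡1 : ∀ {n} (V : Subset n) a → ∣ V ∣ ≡ 1 → ∑[ _ ∈ V ] a ≈ natR R q * a
  sumColourings-const-∣∣≡1 (outside ∷ V) a ∣V∣≡1 = sumColourings-const-∣∣≡1 V a ∣V∣≡1
  sumColourings-const-∣∣≡1 (inside ∷ V)  a ∣V∣≡1 =
    ≈-trans (sumFin-cong q λ _ → sumColourings-const-∣∣≡0 V a (ℕₚ.suc-injective ∣V∣≡1))
            (sumFin-const q a)

  joinWeights-∷ : ∀ {n₁ n₂} a (f₁ : Colouring q n₁) (f₂ : Colouring q n₂) v →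
                  (a VF.∷ joinWeights f₁ f₂) v ≡ joinWeights (a VF.∷ f₁) f₂ v
  joinWeights-∷ a f₁ f₂ zero = refl
  joinWeights-∷ {n₁} a f₁ f₂ (suc v) with splitAt n₁ v
  ... | inj₁ _ = refl
  ... | inj₂ _ = refl

  sumColourings-++ : ∀ {n₁ n₂} (V₁ : Subset n₁) (V₂ : Subset n₂) {F} → Extensional F →
    ∑[ f ∈ V₁ ++ V₂ ] F f
      ≈ ∑[ f₁ ∈ V₁ ] ∑[ f₂ ∈ V₂ ] F (joinWeights f₁ f₂)
  sumColourings-++ []            V₂ ext = sumColourings-cong V₂ λ _ → ext λ _ → refl
  sumColourings-++ (outside ∷ V₁) V₂ ext =
    ≈-trans (sumColourings-++ V₁ V₂ (extensional-∷ ext nothing))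
            (sumColourings-cong V₁ λ f₁ → sumColourings-cong V₂ λ f₂ →
               ext (joinWeights-∷ nothing f₁ f₂))
  sumColourings-++ (inside ∷ V₁)  V₂ ext = sumFin-cong q λ d →
    ≈-trans (sumColourings-++ V₁ V₂ (extensional-∷ ext (just d)))
            (sumColourings-cong V₁ λ f₁ → sumColourings-cong V₂ λ f₂ →
               ext (joinWeights-∷ (just d) f₁ f₂))

  sumColourings-monochrome : ∀ {n} (V e : Subset n) c {F} → Extensional F → e ⊆ V →
    ∑[ f ∈ V ] (if does (monochrome? e c f) then F f else 0#)
      ≈ ∑[ g ∈ V ∩ ∁ e ] F (paint e c g)
  sumColourings-monochrome-outside : ∀ {n} (V e : Subset n) c {F : Colouring q (suc n) → Carrier} →
    Extensional F → e ⊆ V → ∀ a →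
    ∑[ f ∈ V ] (if does (monochrome? (outside ∷ e) c (a VF.∷ f)) then F (a VF.∷ f) else 0#)
      ≈ ∑[ g ∈ V ∩ ∁ e ] F (paint (outside ∷ e) c (a VF.∷ g))

  sumColourings-monochrome [] [] c {F} ext _ =
    ≈-trans (if-congᵇ {x = F (λ ())} {y = 0#} (dec-true (monochrome? [] c (λ ())) λ ())) (ext λ ())
  sumColourings-monochrome (outside ∷ V) (inside ∷ e) c ext e⊆V with e⊆V here
  ... | ()
  sumColourings-monochrome (outside ∷ V) (outside ∷ e) c ext e⊆V =
    sumColourings-monochrome-outside V e c ext (drop-∷-⊆ e⊆V) nothing
  sumColourings-monochrome (inside ∷ V)  (outside ∷ e) c ext e⊆V = sumFin-cong q λ d →
    sumColourings-monochrome-outside V e c ext (drop-∷-⊆ e⊆V) (just d)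
  sumColourings-monochrome (inside ∷ V) (inside ∷ e) c {F} ext e⊆V = begin
    ∑[ d < q ] ∑[ f ∈ V ] (if does (monochrome? (inside ∷ e) c (just d VF.∷ f)) then F (just d VF.∷ f) else 0#)
      ≈⟨ sumFin-cong q (λ d → sumColourings-cong V λ f → if-congᵇ (does-⇔ monochrome-inside
           (monochrome? (inside ∷ e) c (just d VF.∷ f))
           (Maybeₚ.≡-dec _≟ᶠ_ (just d) (just c) ×-dec monochrome? e c f))) ⟩
    ∑[ d < q ] ∑[ f ∈ V ] (if does (d ≟ᶠ c) ∧ does (monochrome? e c f) then F (just d VF.∷ f) else 0#)
      ≈⟨ sumFin-cong q (λ d → sumColourings-if-∧ V (does (d ≟ᶠ c)) _ _) ⟩
    ∑[ d < q ] (if does (d ≟ᶠ c)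
      then ∑[ f ∈ V ] (if does (monochrome? e c f) then F (just d VF.∷ f) else 0#) else 0#)
      ≈⟨ sumFin-δ q c _ ⟩
    ∑[ f ∈ V ] (if does (monochrome? e c f) then F (just c VF.∷ f) else 0#)
      ≈⟨ sumColourings-monochrome V e c (extensional-∷ ext (just c)) (drop-∷-⊆ e⊆V) ⟩
    ∑[ g ∈ V ∩ ∁ e ] F (just c VF.∷ paint e c g)
      ≈⟨ sumColourings-cong (V ∩ ∁ e) (λ g → ext (sym ∘ paint-∷ inside e c nothing g)) ⟩
    ∑[ g ∈ V ∩ ∁ e ] F (paint (inside ∷ e) c (nothing VF.∷ g)) ∎

  sumColourings-monochrome-outside V e c {F} ext e⊆V a = begin
    ∑[ f ∈ V ] (if does (monochrome? (outside ∷ e) c (a VF.∷ f)) then F (a VF.∷ f) else 0#)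
      ≈⟨ sumColourings-cong V (λ f → if-congᵇ (does-⇔ monochrome-outside
           (monochrome? (outside ∷ e) c (a VF.∷ f)) (monochrome? e c f))) ⟩
    ∑[ f ∈ V ] (if does (monochrome? e c f) then F (a VF.∷ f) else 0#)
      ≈⟨ sumColourings-monochrome V e c (extensional-∷ ext a) e⊆V ⟩
    ∑[ g ∈ V ∩ ∁ e ] F (a VF.∷ paint e c g)
      ≈⟨ sumColourings-cong (V ∩ ∁ e) (λ g → ext (sym ∘ paint-∷ outside e c a g)) ⟩
    ∑[ g ∈ V ∩ ∁ e ] F (paint (outside ∷ e) c (a VF.∷ g)) ∎

  primaryEdge-indicator : ∀ p {n} {e : Subset n} → Nonempty e → ∀ f x →
    (if does (primaryEdge? p f e) then x else 0#)
      ≈ ∑[ c < q ] (if does (toℕ c <? p) ∧ does (monochrome? e c f) then x else 0#)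
  primaryEdge-indicator p {e = e} ne f x = indicator (primaryEdge? p f e)
    where
    indicator : (pe? : Dec (PrimaryEdge p f e)) → (if does pe? then x else 0#)
      ≈ ∑[ c < q ] (if does ((toℕ c <? p) ×-dec monochrome? e c f) then x else 0#)
    indicator (yes pe) =
      let (c₀ , c₀<p , mono₀) = primaryEdge⇒monochrome ne pe
          colour≡c₀ : ∀ c → (toℕ c < p × Monochrome e c f) ⇔ c ≡ c₀
          colour≡c₀ c = mk⇔ (λ (_ , mono) → monochrome-unique ne mono mono₀) λ { refl → c₀<p , mono₀ }
      in ≈-sym (≈-trans (sumFin-cong q λ c → if-congᵇ
                           (does-⇔ (colour≡c₀ c) ((toℕ c <? p) ×-dec monochrome? e c f) (c ≟ᶠ c₀)))
                        (sumFin-δ q c₀ (λ _ → x)))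
    indicator (no ¬pe) =
      let notPrimary : ∀ c → ¬ (toℕ c < p × Monochrome e c f)
          notPrimary c (c<p , mono) = ¬pe (monochrome⇒primaryEdge c<p mono)
      in ≈-sym (≈-trans (sumFin-cong q λ c → if-congᵇ
                           (dec-false ((toℕ c <? p) ×-dec monochrome? e c f) (notPrimary c)))
                        (sumFin-zero q))

  sumColourings-primaryEdge : ∀ p {n} (V e : Subset n) {F} → Extensional F → e ⊆ V → Nonempty e →
    ∑[ f ∈ V ] (if does (primaryEdge? p f e) then F f else 0#)
      ≈ ∑[ c < q ] (if does (toℕ c <? p) then ∑[ g ∈ V ∩ ∁ e ] F (paint e c g) else 0#)
  sumColourings-primaryEdge p V e {F} ext e⊆V ne = begin
    ∑[ f ∈ V ] (if does (primaryEdge? p f e) then F f else 0#)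
      ≈⟨ sumColourings-cong V (λ f → primaryEdge-indicator p ne f (F f)) ⟩
    ∑[ f ∈ V ] ∑[ c < q ] (if does (toℕ c <? p) ∧ does (monochrome? e c f) then F f else 0#)
      ≈⟨ sumColourings-sumFin V q _ ⟩
    ∑[ c < q ] ∑[ f ∈ V ] (if does (toℕ c <? p) ∧ does (monochrome? e c f) then F f else 0#)
      ≈⟨ sumFin-cong q (λ c → sumColourings-if-∧ V (does (toℕ c <? p)) _ F) ⟩
    ∑[ c < q ] (if does (toℕ c <? p)
      then ∑[ f ∈ V ] (if does (monochrome? e c f) then F f else 0#) else 0#)
      ≈⟨ sumFin-cong q (λ c → if-cong (does (toℕ c <? p)) (sumColourings-monochrome V e c ext e⊆V) ≈-refl) ⟩
    ∑[ c < q ] (if does (toℕ c <? p) then ∑[ g ∈ V ∩ ∁ e ] F (paint e c g) else 0#) ∎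

module Weights {c ℓ} (R : CommutativeRing c ℓ) (p q : ℕ) where
  open CommutativeRing R hiding (zero) renaming (refl to ≈-refl; sym to ≈-sym; trans to ≈-trans)
  open FiniteSums R
  open ColouringSums R q using (Extensional)

  Active : ∀ {n m} → Hypergraph n m → Colouring q n → Fin m → Set
  Active H f j = j ∈ I H × PrimaryEdge p f (E H j)

  active? : ∀ {n m} (H : Hypergraph n m) f j → Dec (Active H f j)
  active? H f j = (j ∈? I H) ×-dec primaryEdge? p f (E H j)

  active-⇔ : ∀ {n n′ m m′} (H : Hypergraph n m) (H′ : Hypergraph n′ m′) {f f′ j j′} →
    (j ∈ I H ⇔ j′ ∈ I H′) → SameColours f (E H j) f′ (E H′ j′) → Active H f j ⇔ Active H′ f′ j′
  active-⇔ _ _ ∈⇔ same = ∈⇔ ×-⇔ primaryEdge-⇔ same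

  -- primaryWeight R p H t f unfolds to ∏[ j < m ] edgeFactor H t f j.
  edgeFactor : ∀ {n m} → Hypergraph n m → (Fin m → Carrier) → Colouring q n → Fin m → Carrier
  edgeFactor H t f j = if does (active? H f j) then t j else 1#

  edgeFactor-cong : ∀ {n n′ m m′} (H : Hypergraph n m) (H′ : Hypergraph n′ m′) t t′ f f′ j j′ →
    (Active H f j ⇔ Active H′ f′ j′) → t j ≈ t′ j′ → edgeFactor H t f j ≈ edgeFactor H′ t′ f′ j′
  edgeFactor-cong H H′ t t′ f f′ j j′ active⇔ tj≈t′j′ =
    ≈-trans (if-cong (does (active? H f j)) tj≈t′j′ ≈-refl)
            (if-congᵇ (does-⇔ active⇔ (active? H f j) (active? H′ f′ j′)))

  edgeFactor-inactive : ∀ {n m} (H : Hypergraph n m) t f j → ¬ Active H f j → edgeFactor H t f j ≈ 1#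
  edgeFactor-inactive H t f j inactive = if-congᵇ (dec-false (active? H f j) inactive)

  primaryWeight-cong : ∀ {n n′ m} (H : Hypergraph n m) (H′ : Hypergraph n′ m) t f f′ →
    (∀ j → Active H f j ⇔ Active H′ f′ j) → primaryWeight R p H t f ≈ primaryWeight R p H′ t f′
  primaryWeight-cong {m = m} H H′ t f f′ active⇔ =
    prodFin-cong m λ j → edgeFactor-cong H H′ t t f f′ j j (active⇔ j) ≈-refl

  primaryWeight-extensional : ∀ {n m} (H : Hypergraph n m) t → Extensional (primaryWeight R p H t)
  primaryWeight-extensional H t {f} {g} f≗g = primaryWeight-cong H H t f g λ j →
    active-⇔ H H ⇔.refl (sameColours-agree λ {v} _ → f≗g v)

  primaryWeight-noEdges : ∀ {n m} (H : Hypergraph n m) t f → I H ≡ ⊥ → primaryWeight R p H t f ≈ 1#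
  primaryWeight-noEdges {m = m} H t f refl = prodFin-one m λ j → edgeFactor-inactive H t f j (∉⊥ ∘ proj₁)

  primaryWeight-deleteEdge : ∀ {n m} (H : Hypergraph n m) t f {i} → i ∈ I H →
    primaryWeight R p H t f
      ≈ (if does (primaryEdge? p f (E H i)) then t i else 1#) * primaryWeight R p (deleteEdge H i) t f
  primaryWeight-deleteEdge {m = m} H t f {i} i∈ =
    ≈-trans (prodFin-extract m i _ _ unchanged
              (edgeFactor-inactive (deleteEdge H i) t f i (x∉p─⁅x⁆ (I H) i ∘ proj₁)))
            (*-congʳ (if-congᵇ (cong (_∧ does (primaryEdge? p f (E H i))) (dec-true (i ∈? I H) i∈))))
    where
    unchanged : ∀ j → j ≢ i → edgeFactor H t f j ≈ edgeFactor (deleteEdge H i) t f j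
    unchanged j j≢i =
      edgeFactor-cong H (deleteEdge H i) t t f f j j (active-⇔ H (deleteEdge H i) ∈I⇔∈I-i ⇔.refl) ≈-refl
      where
      ∈I⇔∈I-i : j ∈ I H ⇔ j ∈ I H ─ ⁅ i ⁆
      ∈I⇔∈I-i = mk⇔ (λ j∈ → x∈p∧x≢y⇒x∈p-y j∈ j≢i) (p─q⊆p (I H) ⁅ i ⁆)

  primaryWeight-contractEdge : ∀ {n m} (H : Hypergraph n m) t i c g →
    primaryWeight R p (contractEdge H i) t (just c VF.∷ g) ≈ primaryWeight R p (deleteEdge H i) t (paint (E H i) c g)
  primaryWeight-contractEdge H t i c g =
    primaryWeight-cong (contractEdge H i) (deleteEdge H i) t (just c VF.∷ g) (paint (E H i) c g) λ j →
    active-⇔ (contractEdge H i) (deleteEdge H i) ⇔.refl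
      (sameColours-contract (E H j) (E H i) c g (nonempty? (E H j ∩ E H i)))

  primaryWeight-extractEdge : ∀ {n m} (H : Hypergraph n m) t i {c} g → ¬ toℕ c < p →
    primaryWeight R p (deleteEdge H i) t (paint (E H i) c g) ≈ primaryWeight R p (extractEdge H i) t g
  primaryWeight-extractEdge H t i {c} g c≮p =
    primaryWeight-cong (deleteEdge H i) (extractEdge H i) t (paint e c g) g λ j → mk⇔ (to j) (from j)
    where
    e = E H i

    agreeOff : ∀ {j} → ¬ Nonempty (E H j ∩ e) → SameColours (paint e c g) (E H j) g (E H j)
    agreeOff disjoint = sameColours-agree λ v∈ → paint-∉ e c g λ v∈e → disjoint (_ , x∈p∩q⁺ (v∈ , v∈e))

    meets⇒notPrimary : ∀ {j} → Nonempty (E H j ∩ e) → ¬ PrimaryEdge p (paint e c g) (E H j)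
    meets⇒notPrimary {j} (w , w∈) pe =
      let (w∈j , w∈e) = x∈p∩q⁻ (E H j) e w∈
      in c≮p (subst (IsPrimaryColour p) (paint-∈ e c g w∈e) (proj₂ (pe w w w∈j w∈j)))

    to : ∀ j → Active (deleteEdge H i) (paint e c g) j → Active (extractEdge H i) g j
    to j (j∈ , pe) =
      let (j∈I , j≢i) = Equivalence.to x∈p─⁅y⁆⇔ j∈
          disjoint = λ meets → meets⇒notPrimary meets pe
      in Equivalence.from (∈-extractEdge H i j) (j∈I , j≢i , disjoint) ,
         Equivalence.to (primaryEdge-⇔ (agreeOff disjoint)) pe

    from : ∀ j → Active (extractEdge H i) g j → Active (deleteEdge H i) (paint e c g) j
    from j (j∈ , pe) =
      let (j∈I , j≢i , disjoint) = Equivalence.to (∈-extractEdge H i j) j∈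
      in Equivalence.from x∈p─⁅y⁆⇔ (j∈I , j≢i) , Equivalence.from (primaryEdge-⇔ (agreeOff disjoint)) pe

  primaryWeight-disjointUnion : ∀ {n₁ m₁ n₂ m₂} (H₁ : Hypergraph n₁ m₁) (H₂ : Hypergraph n₂ m₂)
                                t₁ t₂ f₁ f₂ →
    primaryWeight R p (disjointUnion H₁ H₂) (joinWeights t₁ t₂) (joinWeights f₁ f₂)
      ≈ primaryWeight R p H₁ t₁ f₁ * primaryWeight R p H₂ t₂ f₂
  primaryWeight-disjointUnion {m₁ = m₁} {m₂ = m₂} H₁ H₂ t₁ t₂ f₁ f₂ =
    ≈-trans (prodFin-++ m₁ m₂ _) (*-cong (prodFin-cong m₁ left) (prodFin-cong m₂ right))
    where
    H = disjointUnion H₁ H₂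
    t = joinWeights t₁ t₂
    f = joinWeights f₁ f₂
    edges = [ (λ j₁ → E H₁ j₁ ++ ⊥) , (λ j₂ → ⊥ ++ E H₂ j₂) ]′

    left : ∀ j → edgeFactor H t f (j ↑ˡ m₂) ≈ edgeFactor H₁ t₁ f₁ j
    left j = edgeFactor-cong H H₁ t t₁ f f₁ (j ↑ˡ m₂) j
      (active-⇔ H H₁ (∈-++ˡ⇔ (I H₁) (I H₂))
        (subst (λ e → SameColours f e f₁ (E H₁ j)) (cong edges (sym (Finₚ.splitAt-↑ˡ m₁ j m₂)))
               (sameColours-joinˡ f₁ f₂ (E H₁ j))))
      (reflexive (cong [ t₁ , t₂ ]′ (Finₚ.splitAt-↑ˡ m₁ j m₂)))

    right : ∀ j → edgeFactor H t f (m₁ ↑ʳ j) ≈ edgeFactor H₂ t₂ f₂ j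
    right j = edgeFactor-cong H H₂ t t₂ f f₂ (m₁ ↑ʳ j) j
      (active-⇔ H H₂ (∈-++ʳ⇔ (I H₁) (I H₂))
        (subst (λ e → SameColours f e f₂ (E H₂ j)) (cong edges (sym (Finₚ.splitAt-↑ʳ m₁ m₂ j)))
               (sameColours-joinʳ f₁ f₂ (E H₂ j))))
      (reflexive (cong [ t₁ , t₂ ]′ (Finₚ.splitAt-↑ʳ m₁ m₂ j)))

module RingIdentities {c ℓ} (R : CommutativeRing c ℓ) where
  open CommutativeRing R hiding (zero) renaming (refl to ≈-refl; sym to ≈-sym; trans to ≈-trans)
  open import Relation.Binary.Reasoning.Setoid setoid
  open import Algebra.Properties.Ring ring using ([y-z]x≈yx-zx)
  open import Algebra.Properties.AbelianGroup +-abelianGroup using (xyx⁻¹≈y)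

  x-1+1-x≈0 : ∀ x → (x - 1#) + (1# - x) ≈ 0#
  x-1+1-x≈0 x = begin
    (x - 1#) + (1# - x) ≈⟨ +-assoc x (- 1#) (1# - x) ⟩
    x + (- 1# + (1# - x)) ≈⟨ +-congˡ (+-assoc (- 1#) 1# (- x)) ⟨
    x + ((- 1# + 1#) - x) ≈⟨ +-congˡ (+-congʳ (-‿inverseˡ 1#)) ⟩
    x + (0# - x)          ≈⟨ +-congˡ (+-identityˡ (- x)) ⟩
    x - x                 ≈⟨ -‿inverseʳ x ⟩
    0#                    ∎

  d+[x-1][a+z]+[1-x]z≈d+[x-1]a : ∀ d x a z → d + (x - 1#) * (a + z) + (1# - x) * z ≈ d + (x - 1#) * a
  d+[x-1][a+z]+[1-x]z≈d+[x-1]a d x a z = begin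
    d + (x - 1#) * (a + z) + (1# - x) * z               ≈⟨ +-congʳ (+-congˡ (distribˡ (x - 1#) a z)) ⟩
    d + ((x - 1#) * a + (x - 1#) * z) + (1# - x) * z    ≈⟨ +-assoc d _ _ ⟩
    d + (((x - 1#) * a + (x - 1#) * z) + (1# - x) * z)  ≈⟨ +-congˡ (+-assoc _ _ _) ⟩
    d + ((x - 1#) * a + ((x - 1#) * z + (1# - x) * z))  ≈⟨ +-congˡ (+-congˡ (distribʳ z (x - 1#) (1# - x))) ⟨
    d + ((x - 1#) * a + ((x - 1#) + (1# - x)) * z)      ≈⟨ +-congˡ (+-congˡ (*-congʳ (x-1+1-x≈0 x))) ⟩
    d + ((x - 1#) * a + 0# * z)                         ≈⟨ +-congˡ (+-congˡ (zeroˡ z)) ⟩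
    d + ((x - 1#) * a + 0#)                             ≈⟨ +-congˡ (+-identityʳ _) ⟩
    d + (x - 1#) * a                                    ∎

  if-1-split : ∀ b x w → (if b then x else 1#) * w ≈ w + (x - 1#) * (if b then w else 0#)
  if-1-split true  x w = ≈-sym (begin
    w + (x - 1#) * w      ≈⟨ +-congˡ ([y-z]x≈yx-zx w x 1#) ⟩
    w + (x * w - 1# * w)  ≈⟨ +-congˡ (+-congˡ (-‿cong (*-identityˡ w))) ⟩
    w + (x * w - w)       ≈⟨ +-assoc w (x * w) (- w) ⟨
    w + x * w - w         ≈⟨ xyx⁻¹≈y w (x * w) ⟩
    x * w                 ∎)
  if-1-split false x w = ≈-trans (*-identityˡ w) (≈-sym (≈-trans (+-congˡ (zeroʳ (x - 1#))) (+-identityʳ w)))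

module ChromaticPolynomial {c ℓ} (R : CommutativeRing c ℓ) (p q : ℕ) where
  open CommutativeRing R hiding (zero) renaming (refl to ≈-refl; sym to ≈-sym; trans to ≈-trans)
  open import Relation.Binary.Reasoning.Setoid setoid
  open FiniteSums R
  open ColouringSums R q
  open Weights R p q
  open RingIdentities R

  chromPoly-empty : ∀ {n m} (H : Hypergraph n m) → V H ≡ ⊥ → I H ≡ ⊥ → (t : Fin m → Carrier) →
                    chromPoly R p q H t ≈ 1#
  chromPoly-empty {n} H V≡⊥ I≡⊥ t =
    ≈-trans (sumColourings-cong (V H) λ f → primaryWeight-noEdges H t f I≡⊥)
            (sumColourings-const-∣∣≡0 (V H) 1# (trans (cong ∣_∣ V≡⊥) (∣⊥∣≡0 n)))

  chromPoly-singleton : ∀ {n m} (H : Hypergraph n m) → ∣ V H ∣ ≡ 1 → I H ≡ ⊥ → (t : Fin m → Carrier) →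
                        chromPoly R p q H t ≈ natR R q
  chromPoly-singleton H ∣V∣≡1 I≡⊥ t =
    ≈-trans (sumColourings-cong (V H) λ f → primaryWeight-noEdges H t f I≡⊥)
            (≈-trans (sumColourings-const-∣∣≡1 (V H) 1# ∣V∣≡1) (*-identityʳ (natR R q)))

  chromPoly-disjointUnion : ∀ {n₁ m₁ n₂ m₂} (H₁ : Hypergraph n₁ m₁) (H₂ : Hypergraph n₂ m₂) t₁ t₂ →
    chromPoly R p q (disjointUnion H₁ H₂) (joinWeights t₁ t₂)
      ≈ chromPoly R p q H₁ t₁ * chromPoly R p q H₂ t₂
  chromPoly-disjointUnion H₁ H₂ t₁ t₂ = begin
    ∑[ f ∈ V H₁ ++ V H₂ ] primaryWeight R p (disjointUnion H₁ H₂) (joinWeights t₁ t₂) f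
      ≈⟨ sumColourings-++ (V H₁) (V H₂) (primaryWeight-extensional (disjointUnion H₁ H₂) _) ⟩
    ∑[ f₁ ∈ V H₁ ] ∑[ f₂ ∈ V H₂ ]
      primaryWeight R p (disjointUnion H₁ H₂) (joinWeights t₁ t₂) (joinWeights f₁ f₂)
      ≈⟨ sumColourings-cong (V H₁) (λ f₁ → sumColourings-cong (V H₂) λ f₂ →
           primaryWeight-disjointUnion H₁ H₂ t₁ t₂ f₁ f₂) ⟩
    ∑[ f₁ ∈ V H₁ ] ∑[ f₂ ∈ V H₂ ] (W₁ f₁ * W₂ f₂)
      ≈⟨ sumColourings-cong (V H₁) (λ f₁ → ≈-trans (sumColourings-*ˡ (V H₂) (W₁ f₁) W₂) (*-comm _ _)) ⟩
    ∑[ f₁ ∈ V H₁ ] (chromPoly R p q H₂ t₂ * W₁ f₁)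
      ≈⟨ ≈-trans (sumColourings-*ˡ (V H₁) _ W₁) (*-comm _ _) ⟩
    chromPoly R p q H₁ t₁ * chromPoly R p q H₂ t₂ ∎
    where
    W₁ = primaryWeight R p H₁ t₁
    W₂ = primaryWeight R p H₂ t₂

  primaryPart : ∀ {n m} → Hypergraph n m → (Fin m → Carrier) → Fin m → Carrier
  primaryPart H t i =
    ∑[ f ∈ V H ] (if does (primaryEdge? p f (E H i)) then primaryWeight R p (deleteEdge H i) t f else 0#)

  chromPoly-deleteEdge : ∀ {n m} (H : Hypergraph n m) t {i} → i ∈ I H →
    chromPoly R p q H t ≈ chromPoly R p q (deleteEdge H i) t + (t i - 1#) * primaryPart H t i
  chromPoly-deleteEdge H t {i} i∈I = begin
    ∑[ f ∈ V H ] primaryWeight R p H t f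
      ≈⟨ sumColourings-cong (V H) (λ f → ≈-trans (primaryWeight-deleteEdge H t f i∈I)
                                                  (if-1-split (isPrimary f) (t i) (w f))) ⟩
    ∑[ f ∈ V H ] (w f + (t i - 1#) * (if isPrimary f then w f else 0#))
      ≈⟨ sumColourings-+ (V H) _ _ ⟩
    chromPoly R p q (deleteEdge H i) t + ∑[ f ∈ V H ] ((t i - 1#) * (if isPrimary f then w f else 0#))
      ≈⟨ +-congˡ (sumColourings-*ˡ (V H) _ _) ⟩
    chromPoly R p q (deleteEdge H i) t + (t i - 1#) * primaryPart H t i ∎
    where
    w = primaryWeight R p (deleteEdge H i) t
    isPrimary = λ f → does (primaryEdge? p f (E H i))

  chromPoly-contractEdge : ∀ {n m} (H : Hypergraph n m) t i → Nonempty (E H i) → E H i ⊆ V H →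
    chromPoly R p q (contractEdge H i) t ≈ primaryPart H t i + natR R (q ∸ p) * chromPoly R p q (extractEdge H i) t
  chromPoly-contractEdge H t i e≠∅ e⊆V = begin
    ∑[ c < q ] ∑[ g ∈ V H ∩ ∁ e ] primaryWeight R p (contractEdge H i) t (just c VF.∷ g)
      ≈⟨ sumFin-cong q (λ c → sumColourings-cong (V H ∩ ∁ e) (primaryWeight-contractEdge H t i c)) ⟩
    ∑[ c < q ] S c
      ≈⟨ sumFin-partition q (λ c → does (toℕ c <? p)) S ⟩
    ∑[ c < q ] (if does (toℕ c <? p) then S c else 0#) + ∑[ c < q ] (if does (toℕ c <? p) then 0# else S c)
      ≈⟨ +-cong (≈-sym (sumColourings-primaryEdge p (V H) e (primaryWeight-extensional (deleteEdge H i) t) e⊆V e≠∅))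
                (sumFin-cong q nonPrimary) ⟩
    primaryPart H t i + ∑[ c < q ] (if does (toℕ c <? p) then 0# else P†e)
      ≈⟨ +-congˡ (sumFin-const-≥ q p P†e) ⟩
    primaryPart H t i + natR R (q ∸ p) * P†e ∎
    where
    e = E H i
    P†e = chromPoly R p q (extractEdge H i) t
    S : Fin q → Carrier
    S c = ∑[ g ∈ V H ∩ ∁ e ] primaryWeight R p (deleteEdge H i) t (paint e c g)

    nonPrimary : ∀ c → (if does (toℕ c <? p) then 0# else S c) ≈ (if does (toℕ c <? p) then 0# else P†e)
    nonPrimary c = if-does-congʳ (toℕ c <? p) λ c≮p →
      sumColourings-cong (V H ∩ ∁ e) λ g → primaryWeight-extractEdge H t i g c≮p

  chromPoly-deletion-contraction-extraction : ∀ {n m} (H : Hypergraph n m) (t : Fin m → Carrier) i →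
    i ∈ I H → Nonempty (E H i) → E H i ⊆ V H →
    chromPoly R p q H t
      ≈ chromPoly R p q (deleteEdge H i) t
        + (t i - 1#) * chromPoly R p q (contractEdge H i) t
        + (1# - t i) * natR R (q ∸ p) * chromPoly R p q (extractEdge H i) t
  chromPoly-deletion-contraction-extraction H t i i∈I e≠∅ e⊆V = begin
    chromPoly R p q H t
      ≈⟨ chromPoly-deleteEdge H t i∈I ⟩
    P-e + (t i - 1#) * A
      ≈⟨ d+[x-1][a+z]+[1-x]z≈d+[x-1]a P-e (t i) A (N * P†e) ⟨
    P-e + (t i - 1#) * (A + N * P†e) + (1# - t i) * (N * P†e)
      ≈⟨ +-cong (+-congˡ (*-congˡ (chromPoly-contractEdge H t i e≠∅ e⊆V))) (*-assoc _ _ _) ⟨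
    P-e + (t i - 1#) * chromPoly R p q (contractEdge H i) t + (1# - t i) * N * P†e ∎
    where
    N = natR R (q ∸ p)
    A = primaryPart H t i
    P-e = chromPoly R p q (deleteEdge H i) t
    P†e = chromPoly R p q (extractEdge H i) t

mainTheorem2 : ∀ {c ℓ} (R : CommutativeRing c ℓ) (p q : ℕ) → 1 ≤ p → p ≤ q →
    let open CommutativeRing R in
    (∀ {n m} (H : Hypergraph n m) → V H ≡ ⊥ → I H ≡ ⊥ → (t : Fin m → Carrier) →
       chromPoly R p q H t ≈ 1#)
    × (∀ {n m} (H : Hypergraph n m) → ∣ V H ∣ ≡ 1 → I H ≡ ⊥ → (t : Fin m → Carrier) →
       chromPoly R p q H t ≈ natR R q)
    × (∀ {n₁ m₁ n₂ m₂} (H₁ : Hypergraph n₁ m₁) (H₂ : Hypergraph n₂ m₂) →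
       WellFormed H₁ → WellFormed H₂ →
       (t₁ : Fin m₁ → Carrier) (t₂ : Fin m₂ → Carrier) →
       chromPoly R p q (disjointUnion H₁ H₂) (joinWeights t₁ t₂)
         ≈ chromPoly R p q H₁ t₁ * chromPoly R p q H₂ t₂)
    × (∀ {n m} (H : Hypergraph n m) → WellFormed H → (t : Fin m → Carrier) →
       (i : Fin m) → i ∈ I H →
       chromPoly R p q H t
         ≈ chromPoly R p q (deleteEdge H i) t
           + (t i - 1#) * chromPoly R p q (contractEdge H i) t
           + (1# - t i) * natR R (q ∸ p) * chromPoly R p q (extractEdge H i) t)
mainTheorem2 R p q _ _ =
  chromPoly-empty ,
  chromPoly-singleton ,
  (λ H₁ H₂ _ _ → chromPoly-disjointUnion H₁ H₂) ,
  λ H wf t i i∈I → let (e≠∅ , e⊆V) = wf i i∈I in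
    chromPoly-deletion-contraction-extraction H t i i∈I e≠∅ e⊆V
  where open ChromaticPolynomial R p q
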